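{- Let $K$ be a stable class of models and $n\in\mathbb N$. Then $K_n=\{\mathcal W\in MOD_S:\ \forall w\in\mathcal W\ \exists\,\mathcal U\in K\ \ \mathcal U\sim_n\mathcal W_w\}$ is the smallest class containing $K$ that has the form $MOD_S(\phi)$ for some formula $\phi$ with $d(\phi)\le n$.
   Context: Language: propositional variables from a fixed finite list $p_1,\dots,p_k$, $\top,\bot$, Boolean connectives, modalities $[0],[1]$. Modal depth: $d(p)=d(\top)=d(\bot)=0$, $d(\phi\circ\psi)=\max$, $d([i]\phi)=1+d(\phi)$. A stratified model $\langle W,R_0,R_1,v\rangle$: $W$ finite nonempty, $R_0,R_1$ irreflexive transitive, with (a) $xR_1y\Rightarrow\forall z(xR_0z\iff yR_0z)$; (b) for $m\le n$, $xR_my\wedge yR_nz\Rightarrow xR_mz$; (c) $zR_0x\wedge yR_1x\Rightarrow zR_0y$. $MOD_S$ is the class of finite stratified models with a root (generated by one world); "model" means a member of $MOD_S$. $\mathcal W_w$ is the submodel generated by $w$. $MOD_S(\phi)=\{\mathcal W\in MOD_S:\phi\text{ true at every world of }\mathcal W\}$. A class $K$ is stable if $\mathcal W\in K$ implies $\mathcal W_x\in K$ for all $x\in\mathcal W$. $n$-bisimulation: $\mathcal W_x\sim_0\mathcal W'_{x'}$ iff $x,x'$ satisfy the same variables; $\mathcal W_x\sim_{n+1}\mathcal W'_{x'}$ iff they are $\sim_0$ and for each $i\in\{0,1\}$ every $R_i$-successor $y$ of $x$ has an $R_i$-successor $y'$ of $x'$ with $\mathcal W_y\sim_n\mathcal W'_{y'}$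 and vice versa. -}

module Defs where

open import Level using (0ℓ) renaming (suc to lsuc)
open import Data.Nat using (ℕ; zero; suc; _⊔_)
open import Data.Fin using (Fin) renaming (zero to fz; suc to fs; _≤_ to _≤ᶠ_)
open import Data.Fin.Properties using (any?)
open import Data.Bool using (Bool; true; false; T)
open import Data.Unit using (⊤; tt)
open import Data.Empty using (⊥; ⊥-elim)
open import Data.Product using (Σ; ∃; _×_; _,_; proj₁; proj₂)
open import Data.Sum using (_⊎_; inj₁; inj₂)
open import Data.List using (List; []; _∷_)
open import Data.List.Membership.Propositional using (_∈_)
open import Data.List.Relation.Unary.Any using (here; there)
open import Relation.Nullary using (¬_; Dec; yes; no)
open import Relation.Nullary.Decidable using (True; fromWitness; toWitness; _⊎-dec_)
open import Relation.Binary.Definitions using (DecidableEquality)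
open import Relation.Binary.PropositionalEquality using (_≡_; refl; cong; sym)
open import Relation.Binary.Construct.Closure.ReflexiveTransitive using (Star; ε; _◅_)

data Form (k : ℕ) : Set where
  var      : Fin k → Form k
  ⊤'       : Form k
  ⊥'       : Form k
  ¬'_      : Form k → Form k
  _∧'_     : Form k → Form k → Form k
  _∨'_     : Form k → Form k → Form k
  _⇒'_     : Form k → Form k → Form k
  _⇔'_     : Form k → Form k → Form k
  [_]_     : Fin 2 → Form k → Form k

depth : ∀ {k} → Form k → ℕ
depth (var _)   = 0
depth ⊤'        = 0
depth ⊥'        = 0
depth (¬' φ)    = depth φ
depth (φ ∧' ψ)  = depth φ ⊔ depth ψ
depth (φ ∨' ψ)  = depth φ ⊔ depth ψ
depth (φ ⇒' ψ)  = depth φ ⊔ depth ψ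
depth (φ ⇔' ψ)  = depth φ ⊔ depth ψ
depth ([ i ] φ) = suc (depth φ)

-- Finiteness: decidable equality + a complete list of worlds (Bishop
-- finiteness); the relations are required decidable (automatic
-- classically on a finite set).

record Model (k : ℕ) : Set₁ where
  field
    W        : Set
    _≟_      : DecidableEquality W
    elems    : List W
    complete : ∀ x → x ∈ elems
    R        : Fin 2 → W → W → Set
    R?       : ∀ i x y → Dec (R i x y)
    V        : Fin k → W → Bool
    irrefl   : ∀ i x → ¬ R i x x
    trans    : ∀ i {x y z} → R i x y → R i y z → R i x z
    condA    : ∀ {x y} → R (fs fz) x y → ∀ z → (R fz x z → R fz y z) × (R fz y z → R fz x z)
    condB    : ∀ {m n : Fin 2} {x y z} → m ≤ᶠ n → R m x y → R n y z → R m x z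
    condC    : ∀ {x y z} → R fz z x → R (fs fz) y x → R fz z y
    root     : W
    rooted   : ∀ x → Star (λ a b → Σ (Fin 2) λ i → R i a b) root x

open Model public

_,_⊨_ : ∀ {k} (M : Model k) → W M → Form k → Set
M , x ⊨ var p    = T (V M p x)
M , x ⊨ ⊤'       = ⊤
M , x ⊨ ⊥'       = ⊥
M , x ⊨ (¬' φ)   = ¬ (M , x ⊨ φ)
M , x ⊨ (φ ∧' ψ) = (M , x ⊨ φ) × (M , x ⊨ ψ)
M , x ⊨ (φ ∨' ψ) = (M , x ⊨ φ) ⊎ (M , x ⊨ ψ)
M , x ⊨ (φ ⇒' ψ) = (M , x ⊨ φ) → (M , x ⊨ ψ)
M , x ⊨ (φ ⇔' ψ) = ((M , x ⊨ φ) → (M , x ⊨ ψ)) × ((M , x ⊨ ψ) → (M , x ⊨ φ))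
M , x ⊨ ([ i ] φ) = ∀ y → R M i x y → M , y ⊨ φ

Class : ℕ → Set₂
Class k = Model k → Set₁

MOD : ∀ {k} → Form k → Model k → Set
MOD φ M = ∀ x → M , x ⊨ φ

-- In a stratified model the worlds reachable
-- from w by R_0 ∪ R_1 are exactly w and its one-step R_0/R_1
-- successors (closure follows from transitivity, (a) and (b)), so the
-- carrier is {w} ∪ R_0[w] ∪ R_1[w].

private
  T-irr : ∀ {b} (p q : T b) → p ≡ q
  T-irr {true} p q = refl

  module Sub {A : Set} {P : A → Set} (P? : ∀ a → Dec (P a)) where
    S : Set
    S = Σ A λ a → True (P? a)

    decS : DecidableEquality A → DecidableEquality S
    decS _≟A_ (a , p) (b , q) with a ≟A b
    ... | yes refl = yes (cong (a ,_) (T-irr p q))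
    ... | no a≢b = no λ { refl → a≢b refl }

    consIf : ∀ {Q : Set} {B : Set} → Dec Q → (Q → B) → List B → List B
    consIf (yes q) f l = f q ∷ l
    consIf (no _)  f l = l

    consIf-here : ∀ {Q B : Set} (d : Dec Q) (f : Q → B) → (∀ q q' → f q ≡ f q') →
                  ∀ l (q : Q) {b} → f q ≡ b → b ∈ consIf d f l
    consIf-here (yes q') f fc l q refl = here (fc q q')
    consIf-here (no ¬q) f fc l q _ = ⊥-elim (¬q q)

    consIf-there : ∀ {Q B : Set} (d : Dec Q) (f : Q → B) l {b} → b ∈ l → b ∈ consIf d f l
    consIf-there (yes _) f l m = there m
    consIf-there (no _)  f l m = m

    subList : List A → List S
    subList [] = []
    subList (x ∷ xs) = consIf (P? x) (λ px → x , fromWitness px) (subList xs)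

    subComplete : ∀ {xs} (s : S) → proj₁ s ∈ xs → s ∈ subList xs
    subComplete {x ∷ xs} (a , q) (here refl) =
      consIf-here (P? x) _ (λ _ _ → cong (x ,_) (T-irr _ _)) (subList xs) (toWitness q) (cong (x ,_) (T-irr _ q))
    subComplete {x ∷ xs} s (there m) = consIf-there (P? x) _ (subList xs) (subComplete s m)

gen : ∀ {k} (M : Model k) → W M → Model k
gen {k} M w = record
  { W        = S
  ; _≟_      = decS (_≟_ M)
  ; elems    = subList (elems M)
  ; complete = λ s → subComplete s (complete M (proj₁ s))
  ; R        = λ i s t → R M i (proj₁ s) (proj₁ t)
  ; R?       = λ i s t → R? M i (proj₁ s) (proj₁ t)
  ; V        = λ p s → V M p (proj₁ s)
  ; irrefl   = λ i s → irrefl M i (proj₁ s)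
  ; trans    = λ i → trans M i
  ; condA    = λ r z → condA M r (proj₁ z)
  ; condB    = condB M
  ; condC    = condC M
  ; root     = w , fromWitness (inj₁ refl)
  ; rooted   = rt
  }
  where
  InGen : W M → Set
  InGen y = (y ≡ w) ⊎ Σ (Fin 2) (λ i → R M i w y)
  InGen? : ∀ y → Dec (InGen y)
  InGen? y = _≟_ M y w ⊎-dec any? (λ i → R? M i w y)
  open Sub InGen?
  rt : ∀ s → Star (λ a b → Σ (Fin 2) λ i → R M i (proj₁ a) (proj₁ b)) (w , fromWitness (inj₁ refl)) s
  rt (y , q) = rt' y q (toWitness {a? = InGen? y} q)
    where
    rt' : ∀ y (q : True (InGen? y)) → InGen y →
          Star (λ a b → Σ (Fin 2) λ i → R M i (proj₁ a) (proj₁ b)) (w , fromWitness (inj₁ refl)) (y , q)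
    rt' .w q (inj₁ refl) = Relation.Binary.PropositionalEquality.subst
                      (λ q' → Star _ (w , fromWitness (inj₁ refl)) (w , q'))
                      (T-irr _ q) ε
    rt' y q (inj₂ (i , r)) = (i , r) ◅ ε

-- n-bisimulation between rooted models (at their roots):
-- 𝒲_x ~_n 𝒲'_{x'} is  gen 𝒲 x ≈[ n ] gen 𝒲' x'.

SameVars : ∀ {k} (M N : Model k) → Set
SameVars M N = ∀ p → V M p (root M) ≡ V N p (root N)

_≈[_]_ : ∀ {k} → Model k → ℕ → Model k → Set
M ≈[ zero ] N  = SameVars M N
M ≈[ suc n ] N = SameVars M N
  × (∀ i → (∀ y → R M i (root M) y → Σ (W N) λ y' → R N i (root N) y' × (gen M y ≈[ n ] gen N y'))
         × (∀ y' → R N i (root N) y' → Σ (W M) λ y → R M i (root M) y × (gen M y ≈[ n ] gen N y')))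

Stable : ∀ {k} → Class k → Set₁
Stable K = ∀ M → K M → ∀ x → K (gen M x)

Kn : ∀ {k} → Class k → ℕ → Class k
Kn K n M = ∀ w → Σ (Model _) λ U → K U × (U ≈[ n ] gen M w)

-- Truth at the root of a formula of depth ≤ n is invariant under ≈[ n ], since the truth of a
-- formula at a world only depends on the submodel the world generates; hence K ⊆ Kn K n
-- (by stability) and Kn K n lies inside every MOD φ with depth φ ≤ n that contains K.
-- For definability one builds, classically, a finite list of depth-n "types" such that every
-- rooted model satisfies one of them and any two models satisfying the same one are
-- n-bisimilar: a 0-type fixes the valuation, and an (n+1)-type adds, for each modality i,
-- the cover formula ∇ i S saying that S is exactly the set of n-types realised at i-successors.
-- Kn K n is then defined by the disjunction of the n-types realised at roots of models in K.
module Submission where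

open import Defs
open import Level using (0ℓ; lift; lower) renaming (suc to lsuc)
open import Axiom.ExcludedMiddle using (ExcludedMiddle)
open import Axiom.DoubleNegationElimination using (DoubleNegationElimination; em⇒dne)
open import Data.Nat using (ℕ; _≤_; zero; suc; z≤n; s≤s)
open import Data.Nat.Properties using (⊔-lub; ≤-trans; m⊔n≤o⇒m≤o; m⊔n≤o⇒n≤o)
open import Data.Product using (Σ; ∃; _×_; _,_; proj₁; proj₂)
open import Data.Product.Function.NonDependent.Propositional using (_×-⇔_)
open import Data.Sum using (_⊎_; inj₁; inj₂)
open import Data.Sum.Function.Propositional using (_⊎-⇔_)
open import Data.Fin using (Fin) renaming (zero to fz; suc to fs)
open import Data.Bool using (true; false; T)
open import Data.Unit using (tt)
open import Data.List using (List; []; _∷_; map; _++_; filter; cartesianProductWith; allFin)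
open import Data.List.Membership.Propositional using (_∈_; find; lose)
open import Data.List.Membership.Propositional.Properties
  using (∈-map⁺; ∈-map⁻; ∈-++⁺ˡ; ∈-++⁺ʳ; ∈-++⁻; ∈-allFin; ∈-filter⁺; ∈-filter⁻;
         ∈-cartesianProductWith⁺; ∈-cartesianProductWith⁻)
open import Data.List.Relation.Binary.Subset.Propositional using (_⊆_)
open import Data.List.Relation.Unary.All as All using (All; []; _∷_)
open import Data.List.Relation.Unary.All.Properties as All using ()
open import Data.List.Relation.Unary.Any using (Any; here; there)
open import Relation.Nullary using (¬_; Dec; yes; no; contradiction)
open import Relation.Nullary.Decidable using (fromWitness; toWitness; map′; T?; does)
open import Relation.Binary.PropositionalEquality using (_≡_; refl)
open import Function.Bundles using (_⇔_; mk⇔; Equivalence)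
open import Function.Construct.Identity using (⇔-id)
open import Function.Related.TypeIsomorphisms using (¬-cong-⇔; →-cong-⇔)

open Equivalence using (to; from)

_⊨ᵣ_ : ∀ {k} → Model k → Form k → Set
M ⊨ᵣ φ = M , root M ⊨ φ

module _ {k} (M : Model k) (w : W M) where

  -- The carrier predicate of gen M w (private in Defs).
  InGen : W M → Set
  InGen y = (y ≡ w) ⊎ Σ (Fin 2) (λ i → R M i w y)

  InGen-closed : ∀ {x y} i → InGen x → R M i x y → InGen y
  InGen-closed i       (inj₁ refl)         r = inj₂ (i , r)
  InGen-closed i       (inj₂ (fz , r′))    r = inj₂ (fz , condB M z≤n r′ r)
  InGen-closed fz      (inj₂ (fs fz , r′)) r = inj₂ (fz , proj₂ (condA M r′ _) r)
  InGen-closed (fs fz) (inj₂ (fs fz , r′)) r = inj₂ (fs fz , condB M (s≤s z≤n) r′ r)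

  ⊨-gen : ∀ φ (s : W (gen M w)) → (M , proj₁ s ⊨ φ) ⇔ (gen M w , s ⊨ φ)
  ⊨-gen (var p)   s = ⇔-id _
  ⊨-gen ⊤'        s = ⇔-id _
  ⊨-gen ⊥'        s = ⇔-id _
  ⊨-gen (¬' φ)    s = ¬-cong-⇔ (⊨-gen φ s)
  ⊨-gen (φ ∧' ψ)  s = ⊨-gen φ s ×-⇔ ⊨-gen ψ s
  ⊨-gen (φ ∨' ψ)  s = ⊨-gen φ s ⊎-⇔ ⊨-gen ψ s
  ⊨-gen (φ ⇒' ψ)  s = →-cong-⇔ (⊨-gen φ s) (⊨-gen ψ s)
  ⊨-gen (φ ⇔' ψ)  s = →-cong-⇔ (⊨-gen φ s) (⊨-gen ψ s) ×-⇔ →-cong-⇔ (⊨-gen ψ s) (⊨-gen φ s)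
  ⊨-gen ([ i ] φ) (_ , q) = mk⇔
    (λ h t r → to (⊨-gen φ t) (h (proj₁ t) r))
    (λ h y r → from (⊨-gen φ (y , fromWitness (InGen-closed i (toWitness q) r))) (h _ r))

  ⊨-gen-root : ∀ φ → (M , w ⊨ φ) ⇔ (gen M w ⊨ᵣ φ)
  ⊨-gen-root φ = ⊨-gen φ (root (gen M w))

≈⇒SameVars : ∀ {k} {M N : Model k} n → M ≈[ n ] N → SameVars M N
≈⇒SameVars zero    b = b
≈⇒SameVars (suc n) b = proj₁ b

≈-refl : ∀ {k} n (M : Model k) → M ≈[ n ] M
≈-refl zero    M p = refl
≈-refl (suc n) M = (λ p → refl) , λ i → (λ y r → y , r , ≈-refl n (gen M y))
                                        , (λ y r → y , r , ≈-refl n (gen M y))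

⊨ᵣ-resp-≈ : ∀ {k n} (φ : Form k) {M N} → M ≈[ n ] N → depth φ ≤ n → (M ⊨ᵣ φ) ⇔ (N ⊨ᵣ φ)
⊨ᵣ-resp-≈ {n = n} (var p) b d rewrite ≈⇒SameVars n b p = ⇔-id _
⊨ᵣ-resp-≈ ⊤'       b d = ⇔-id _
⊨ᵣ-resp-≈ ⊥'       b d = ⇔-id _
⊨ᵣ-resp-≈ (¬' φ)   b d = ¬-cong-⇔ (⊨ᵣ-resp-≈ φ b d)
⊨ᵣ-resp-≈ (φ ∧' ψ) b d = ⊨ᵣ-resp-≈ φ b (m⊔n≤o⇒m≤o _ _ d) ×-⇔ ⊨ᵣ-resp-≈ ψ b (m⊔n≤o⇒n≤o _ _ d)
⊨ᵣ-resp-≈ (φ ∨' ψ) b d = ⊨ᵣ-resp-≈ φ b (m⊔n≤o⇒m≤o _ _ d) ⊎-⇔ ⊨ᵣ-resp-≈ ψ b (m⊔n≤o⇒n≤o _ _ d)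
⊨ᵣ-resp-≈ (φ ⇒' ψ) b d =
  →-cong-⇔ (⊨ᵣ-resp-≈ φ b (m⊔n≤o⇒m≤o _ _ d)) (⊨ᵣ-resp-≈ ψ b (m⊔n≤o⇒n≤o _ _ d))
⊨ᵣ-resp-≈ (φ ⇔' ψ) b d =
  let φ⇔ = ⊨ᵣ-resp-≈ φ b (m⊔n≤o⇒m≤o _ _ d) ; ψ⇔ = ⊨ᵣ-resp-≈ ψ b (m⊔n≤o⇒n≤o _ _ d)
  in →-cong-⇔ φ⇔ ψ⇔ ×-⇔ →-cong-⇔ ψ⇔ φ⇔
⊨ᵣ-resp-≈ {n = suc n} ([ i ] φ) {M} {N} (_ , zig) (s≤s d) = mk⇔
  (λ h y′ r′ → let y , r , b = proj₂ (zig i) y′ r′ in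
     from (⊨-gen-root N y′ φ) (to (⊨ᵣ-resp-≈ φ b d) (to (⊨-gen-root M y φ) (h y r))))
  (λ h y r → let y′ , r′ , b = proj₁ (zig i) y r in
     from (⊨-gen-root M y φ) (from (⊨ᵣ-resp-≈ φ b d) (to (⊨-gen-root N y′ φ) (h y′ r′))))

⋀ : ∀ {k} → List (Form k) → Form k
⋀ []       = ⊤'
⋀ (φ ∷ φs) = φ ∧' ⋀ φs

⋁ : ∀ {k} → List (Form k) → Form k
⋁ []       = ⊥'
⋁ (φ ∷ φs) = φ ∨' ⋁ φs

module _ {k} (M : Model k) (x : W M) where

  ⊨-⋀ : ∀ φs → (M , x ⊨ ⋀ φs) ⇔ All (λ φ → M , x ⊨ φ) φs
  ⊨-⋀ φs = mk⇔ (⋀⇒All φs) (All⇒⋀ φs)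
    where
    ⋀⇒All : ∀ φs → M , x ⊨ ⋀ φs → All (λ φ → M , x ⊨ φ) φs
    ⋀⇒All []       _       = []
    ⋀⇒All (φ ∷ φs) (h , g) = h ∷ ⋀⇒All φs g
    All⇒⋀ : ∀ φs → All (λ φ → M , x ⊨ φ) φs → M , x ⊨ ⋀ φs
    All⇒⋀ []       []       = tt
    All⇒⋀ (φ ∷ φs) (h ∷ hs) = h , All⇒⋀ φs hs

  ⊨-⋁ : ∀ φs → (M , x ⊨ ⋁ φs) ⇔ Any (λ φ → M , x ⊨ φ) φs
  ⊨-⋁ φs = mk⇔ (⋁⇒Any φs) (Any⇒⋁ φs)
    where
    ⋁⇒Any : ∀ φs → M , x ⊨ ⋁ φs → Any (λ φ → M , x ⊨ φ) φs
    ⋁⇒Any (φ ∷ φs) (inj₁ h) = here h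
    ⋁⇒Any (φ ∷ φs) (inj₂ h) = there (⋁⇒Any φs h)
    Any⇒⋁ : ∀ φs → Any (λ φ → M , x ⊨ φ) φs → M , x ⊨ ⋁ φs
    Any⇒⋁ (φ ∷ φs) (here h)  = inj₁ h
    Any⇒⋁ (φ ∷ φs) (there h) = inj₂ (Any⇒⋁ φs h)

depth-⋀ : ∀ {k n} (φs : List (Form k)) → All (λ φ → depth φ ≤ n) φs → depth (⋀ φs) ≤ n
depth-⋀ []       []       = z≤n
depth-⋀ (φ ∷ φs) (d ∷ ds) = ⊔-lub d (depth-⋀ φs ds)

depth-⋁ : ∀ {k n} (φs : List (Form k)) → All (λ φ → depth φ ≤ n) φs → depth (⋁ φs) ≤ n
depth-⋁ []       []       = z≤n
depth-⋁ (φ ∷ φs) (d ∷ ds) = ⊔-lub d (depth-⋁ φs ds)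

module _ {A : Set} where

  sublists : List A → List (List A)
  sublists []       = [] ∷ []
  sublists (x ∷ xs) = map (x ∷_) (sublists xs) ++ sublists xs

  ∈-sublists⇒⊆ : ∀ {ys} xs → ys ∈ sublists xs → ys ⊆ xs
  ∈-sublists⇒⊆ []       (here refl) ()
  ∈-sublists⇒⊆ (x ∷ xs) m with ∈-++⁻ (map (x ∷_) (sublists xs)) m
  ... | inj₂ m′ = λ z∈ → there (∈-sublists⇒⊆ xs m′ z∈)
  ... | inj₁ m′ with ∈-map⁻ (x ∷_) m′
  ... | _ , m″ , refl = λ { (here refl) → here refl ; (there z∈) → there (∈-sublists⇒⊆ xs m″ z∈) }

  filter-∈-sublists : ∀ {p} {P : A → Set p} (P? : ∀ x → Dec (P x)) xs → filter P? xs ∈ sublists xs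
  filter-∈-sublists P? []       = here refl
  filter-∈-sublists P? (x ∷ xs) with does (P? x)
  ... | true  = ∈-++⁺ˡ (∈-map⁺ (x ∷_) (filter-∈-sublists P? xs))
  ... | false = ∈-++⁺ʳ (map (x ∷_) (sublists xs)) (filter-∈-sublists P? xs)

module _ {k : ℕ} where

  Covers : List (Form k) → Set₁
  Covers χs = ∀ M → ∃ λ χ → χ ∈ χs × M ⊨ᵣ χ

  Determines : (Model k → Model k → Set) → List (Form k) → Set₁
  Determines ρ χs = ∀ {χ} → χ ∈ χs → ∀ M N → M ⊨ᵣ χ → N ⊨ᵣ χ → ρ M N

  DepthBounded : ℕ → List (Form k) → Set
  DepthBounded n χs = ∀ {χ} → χ ∈ χs → depth χ ≤ n

  Determines-mono : ∀ {ρ σ χs} → (∀ {M N} → ρ M N → σ M N) → Determines ρ χs → Determines σ χs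
  Determines-mono ρ⇒σ det m M N hM hN = ρ⇒σ (det m M N hM hN)

  DepthBounded-mono : ∀ {m n χs} → m ≤ n → DepthBounded m χs → DepthBounded n χs
  DepthBounded-mono m≤n d χ∈ = ≤-trans (d χ∈) m≤n

  conj : List (Form k) → List (Form k) → List (Form k)
  conj = cartesianProductWith _∧'_

  conj-covers : ∀ {φs ψs} → Covers φs → Covers ψs → Covers (conj φs ψs)
  conj-covers cφ cψ M =
    let φ , φ∈ , hφ = cφ M ; ψ , ψ∈ , hψ = cψ M
    in φ ∧' ψ , ∈-cartesianProductWith⁺ _∧'_ φ∈ ψ∈ , hφ , hψ

  conj-determines : ∀ {ρ σ φs ψs} → Determines ρ φs → Determines σ ψs →
                    Determines (λ M N → ρ M N × σ M N) (conj φs ψs)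
  conj-determines {φs = φs} {ψs} dφ dψ m M N hM hN with ∈-cartesianProductWith⁻ _∧'_ φs ψs m
  ... | φ , ψ , φ∈ , ψ∈ , refl = dφ φ∈ M N (proj₁ hM) (proj₁ hN) , dψ ψ∈ M N (proj₂ hM) (proj₂ hN)

  conj-depth : ∀ {n φs ψs} → DepthBounded n φs → DepthBounded n ψs → DepthBounded n (conj φs ψs)
  conj-depth {φs = φs} {ψs} dφ dψ m with ∈-cartesianProductWith⁻ _∧'_ φs ψs m
  ... | φ , ψ , φ∈ , ψ∈ , refl = ⊔-lub (dφ φ∈) (dψ ψ∈)

  SameVar : Fin k → Model k → Model k → Set
  SameVar p M N = V M p (root M) ≡ V N p (root N)

  literal : Fin k → List (Form k)
  literal p = var p ∷ (¬' var p) ∷ []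

  literal-covers : ∀ p → Covers (literal p)
  literal-covers p M with T? (V M p (root M))
  ... | yes h = var p , here refl , h
  ... | no ¬h = ¬' var p , there (here refl) , ¬h

  literal-determines : ∀ p → Determines (SameVar p) (literal p)
  literal-determines p (here refl)         M N hM hN = T-both hM hN
    where
    T-both : ∀ {a b} → T a → T b → a ≡ b
    T-both {true} {true} _ _ = refl
  literal-determines p (there (here refl)) M N hM hN = ¬T-both hM hN
    where
    ¬T-both : ∀ {a b} → ¬ T a → ¬ T b → a ≡ b
    ¬T-both {false} {false} _  _  = refl
    ¬T-both {true}          ¬a _  = contradiction tt ¬a
    ¬T-both {false} {true}  _  ¬b = contradiction tt ¬b

  literal-depth : ∀ p → DepthBounded 0 (literal p)
  literal-depth p (here refl)         = z≤n
  literal-depth p (there (here refl)) = z≤n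

  valuations : List (Fin k) → List (Form k)
  valuations []       = ⊤' ∷ []
  valuations (p ∷ ps) = conj (literal p) (valuations ps)

  valuations-covers : ∀ ps → Covers (valuations ps)
  valuations-covers []       M = ⊤' , here refl , tt
  valuations-covers (p ∷ ps)   = conj-covers (literal-covers p) (valuations-covers ps)

  valuations-determines : ∀ ps → Determines (λ M N → All (λ p → SameVar p M N) ps) (valuations ps)
  valuations-determines []       (here refl) M N _ _ = []
  valuations-determines (p ∷ ps) =
    Determines-mono (λ (e , es) → e ∷ es)
      (conj-determines (literal-determines p) (valuations-determines ps))

  SameVars-determined : Determines SameVars (valuations (allFin k))
  SameVars-determined =
    Determines-mono (λ same p → All.lookup same (∈-allFin p)) (valuations-determines (allFin k))

  valuations-depth : ∀ ps → DepthBounded 0 (valuations ps)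
  valuations-depth []       (here refl) = z≤n
  valuations-depth (p ∷ ps)             = conj-depth (literal-depth p) (valuations-depth ps)

BackAndForth : ∀ {k} → Fin 2 → (Model k → Model k → Set) → Model k → Model k → Set
BackAndForth i ρ M N =
    (∀ y → R M i (root M) y → Σ (W N) λ y′ → R N i (root N) y′ × ρ (gen M y) (gen N y′))
  × (∀ y′ → R N i (root N) y′ → Σ (W M) λ y → R M i (root M) y × ρ (gen M y) (gen N y′))

◇ : ∀ {k} → Fin 2 → Form k → Form k
◇ i φ = ¬' ([ i ] (¬' φ))

-- Moss's cover modality.
∇ : ∀ {k} → Fin 2 → List (Form k) → Form k
∇ i φs = ⋀ (map (◇ i) φs) ∧' ([ i ] ⋁ φs)

∇s : ∀ {k} → Fin 2 → List (Form k) → List (Form k)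
∇s i χs = map (∇ i) (sublists χs)

∇s-depth : ∀ {k n} {χs : List (Form k)} i → DepthBounded n χs → DepthBounded (suc n) (∇s i χs)
∇s-depth {χs = χs} i d m with ∈-map⁻ (∇ i) m
... | S , S∈ , refl = ⊔-lub (depth-⋀ (map (◇ i) S) (All.map⁺ (All.tabulate λ φ∈ → s≤s (d (S⊆ φ∈)))))
                            (s≤s (depth-⋁ S (All.tabulate λ φ∈ → d (S⊆ φ∈))))
  where
  S⊆ : S ⊆ χs
  S⊆ = ∈-sublists⇒⊆ χs S∈

module Classical (em : ExcludedMiddle (lsuc 0ℓ)) {k : ℕ} where

  dec : (P : Set) → Dec P
  dec P = map′ lower lift em

  dne : DoubleNegationElimination 0ℓ
  dne = em⇒dne (λ {P} → dec P)

  ⊨-◇ : ∀ (M : Model k) x i φ → (M , x ⊨ ◇ i φ) ⇔ (∃ λ y → R M i x y × M , y ⊨ φ)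
  ⊨-◇ M x i φ = mk⇔ (λ h → dne λ ¬∃ → h λ y r hy → ¬∃ (y , r , hy))
                    (λ (y , r , hy) h → h y r hy)

  ∇s-covers : ∀ {χs} i → Covers χs → Covers (∇s i χs)
  ∇s-covers {χs} i cov M = ∇ i S , ∈-map⁺ (∇ i) (filter-∈-sublists Realised? χs) , ◇-all , □-any
    where
    Realised : Form k → Set
    Realised χ = ∃ λ y → R M i (root M) y × M , y ⊨ χ
    Realised? : ∀ χ → Dec (Realised χ)
    Realised? χ = dec (Realised χ)
    S : List (Form k)
    S = filter Realised? χs
    ◇-all : M ⊨ᵣ ⋀ (map (◇ i) S)
    ◇-all = from (⊨-⋀ M (root M) (map (◇ i) S))
                 (All.map⁺ (All.tabulate λ {χ} χ∈ →
                    from (⊨-◇ M (root M) i χ) (proj₂ (∈-filter⁻ Realised? {xs = χs} χ∈))))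
    □-any : M ⊨ᵣ ([ i ] ⋁ S)
    □-any y r =
      let χ , χ∈ , h = cov (gen M y) ; hy = from (⊨-gen-root M y χ) h
      in from (⊨-⋁ M y S) (lose (∈-filter⁺ Realised? χ∈ (y , r , hy)) hy)

  ∇-match : ∀ {i S} (M N : Model k) → M ⊨ᵣ ([ i ] ⋁ S) → N ⊨ᵣ ⋀ (map (◇ i) S) →
            ∀ y → R M i (root M) y →
            ∃ λ y′ → R N i (root N) y′ × ∃ λ χ → χ ∈ S × M , y ⊨ χ × N , y′ ⊨ χ
  ∇-match {i} {S} M N □M ◇N y r =
    let χ , χ∈ , hM = find (to (⊨-⋁ M y S) (□M y r))
        y′ , r′ , hN = to (⊨-◇ N (root N) i χ) (All.lookup (All.map⁻ (to (⊨-⋀ N (root N) _) ◇N)) χ∈)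
    in y′ , r′ , χ , χ∈ , hM , hN

  ∇s-determines : ∀ {ρ χs} i → Determines ρ χs → Determines (BackAndForth i ρ) (∇s i χs)
  ∇s-determines {ρ} {χs} i det m M N hM hN with ∈-map⁻ (∇ i) m
  ... | S , S∈ , refl = forth , back
    where
    agree : ∀ {χ y y′} → χ ∈ S → M , y ⊨ χ → N , y′ ⊨ χ → ρ (gen M y) (gen N y′)
    agree {χ} {y} {y′} χ∈ hM hN =
      det (∈-sublists⇒⊆ χs S∈ χ∈) (gen M y) (gen N y′)
          (to (⊨-gen-root M y χ) hM) (to (⊨-gen-root N y′ χ) hN)
    forth : ∀ y → R M i (root M) y → Σ (W N) λ y′ → R N i (root N) y′ × ρ (gen M y) (gen N y′)
    forth y r = let y′ , r′ , χ , χ∈ , hy , hy′ = ∇-match M N (proj₂ hM) (proj₁ hN) y r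
                in y′ , r′ , agree χ∈ hy hy′
    back : ∀ y′ → R N i (root N) y′ → Σ (W M) λ y → R M i (root M) y × ρ (gen M y) (gen N y′)
    back y′ r′ = let y , r , χ , χ∈ , hy′ , hy = ∇-match N M (proj₂ hN) (proj₁ hM) y′ r′
                 in y , r , agree χ∈ hy hy′

  -- Characteristic formulas of the ≈[ n ]-classes, with repetitions and unsatisfiable members.
  types : ℕ → List (Form k)
  types zero    = valuations (allFin k)
  types (suc n) = conj (valuations (allFin k)) (conj (∇s fz (types n)) (∇s (fs fz) (types n)))

  types-covers : ∀ n → Covers (types n)
  types-covers zero    = valuations-covers (allFin k)
  types-covers (suc n) =
    conj-covers (valuations-covers (allFin k))
      (conj-covers (∇s-covers fz (types-covers n)) (∇s-covers (fs fz) (types-covers n)))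

  types-determines : ∀ n → Determines _≈[ n ]_ (types n)
  types-determines zero = SameVars-determined
  types-determines (suc n) =
    Determines-mono (λ (same , bf₀ , bf₁) → same , λ { fz → bf₀ ; (fs fz) → bf₁ })
      (conj-determines SameVars-determined
        (conj-determines (∇s-determines fz (types-determines n))
                         (∇s-determines (fs fz) (types-determines n))))

  types-depth : ∀ n → DepthBounded n (types n)
  types-depth zero    = valuations-depth (allFin k)
  types-depth (suc n) =
    conj-depth (DepthBounded-mono z≤n (valuations-depth (allFin k)))
      (conj-depth (∇s-depth fz (types-depth n)) (∇s-depth (fs fz) (types-depth n)))

  Kn-definable : ∀ (K : Class k) n → Σ (Form k) λ φ → depth φ ≤ n × (∀ M → Kn K n M ⇔ MOD φ M)
  Kn-definable K n =
      ⋁ χs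
    , depth-⋁ χs (All.tabulate λ χ∈ → types-depth n (proj₁ (∈-filter⁻ InK? χ∈)))
    , λ M → mk⇔ (Kn⇒MOD M) (MOD⇒Kn M)
    where
    InK : Form k → Set₁
    InK χ = ∃ λ U → K U × U ⊨ᵣ χ
    InK? : ∀ χ → Dec (InK χ)
    InK? χ = em
    χs : List (Form k)
    χs = filter InK? (types n)
    Kn⇒MOD : ∀ M → Kn K n M → MOD (⋁ χs) M
    Kn⇒MOD M kn x =
      let U , U∈K , U≈ = kn x
          χ , χ∈ , hU = types-covers n U
          hx = from (⊨-gen-root M x χ) (to (⊨ᵣ-resp-≈ χ U≈ (types-depth n χ∈)) hU)
      in from (⊨-⋁ M x χs) (lose (∈-filter⁺ InK? χ∈ (U , U∈K , hU)) hx)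
    MOD⇒Kn : ∀ M → MOD (⋁ χs) M → Kn K n M
    MOD⇒Kn M h w =
      let χ , χ∈ , hw = find (to (⊨-⋁ M w χs) (h w))
          χ∈types , U , U∈K , hU = ∈-filter⁻ InK? χ∈
      in U , U∈K , types-determines n χ∈types U (gen M w) hU (to (⊨-gen-root M w χ) hw)

module _ {k} {K : Class k} {n : ℕ} where

  K⊆Kn : Stable K → ∀ M → K M → Kn K n M
  K⊆Kn stable M M∈K w = gen M w , stable M M∈K w , ≈-refl n (gen M w)

  Kn-least : ∀ φ → depth φ ≤ n → (∀ M → K M → MOD φ M) → ∀ M → Kn K n M → MOD φ M
  Kn-least φ d K⊨φ M kn x =
    let U , U∈K , U≈ = kn x
    in from (⊨-gen-root M x φ) (to (⊨ᵣ-resp-≈ φ U≈ d) (K⊨φ U U∈K (root U)))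

proposition5 : ExcludedMiddle (lsuc 0ℓ) →
    ∀ (k : ℕ) (K : Class k) → Stable K → ∀ (n : ℕ) →
      (∀ M → K M → Kn K n M)
      × Σ (Form k) (λ φ → depth φ ≤ n × (∀ M → Kn K n M ⇔ MOD φ M))
      × (∀ (φ : Form k) → depth φ ≤ n → (∀ M → K M → MOD φ M) → ∀ M → Kn K n M → MOD φ M)
proposition5 em k K stable n = K⊆Kn stable , Classical.Kn-definable em K n , Kn-least
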